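{- Let $p>11$ be a prime with $p\equiv 5\pmod 6$, let $S=\{x\in\{1,2,\dots,\frac{p-5}{6}\}: x\equiv 1\pmod 3\}\subseteq\mathbb{F}_p$, and let $G_p$ be the graph with vertex set $V=S\times\mathbb{F}_p\times\mathbb{F}_p$ in which $x=(x_1,x_2,x_3)$ and $y=(y_1,y_2,y_3)$ are adjacent if and only if $x\ne y$, $x_2+y_3=x_1y_1^{2}$ and $x_3+y_2=x_1^{2}y_1$ (in $\mathbb{F}_p$). If $x,y\in V$ are distinct and have a common neighbour in $G_p$, then $x_1\ne y_1$, $x_2\ne y_2$ and $x_3\ne y_3$. -}

module Defs where

open import Data.Nat using (ℕ; suc; _+_; _*_; _∸_; _<_; _≤_; NonZero)
open import Data.Nat.DivMod using (_%_; _/_)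
open import Data.Product using (_×_; _,_; ∃)
open import Relation.Binary.PropositionalEquality using (_≡_; _≢_)

-- Elements of 𝔽_p are represented by their canonical residues 0,…,p-1 (naturals < p);
-- field operations are ℕ-operations followed by reduction mod p.

Triple : Set
Triple = ℕ × ℕ × ℕ

InS : (p : ℕ) → ℕ → Set
InS p x = 1 ≤ x × x ≤ (p ∸ 5) / 6 × x % 3 ≡ 1

InV : (p : ℕ) → Triple → Set
InV p (x₁ , x₂ , x₃) = InS p x₁ × x₂ < p × x₃ < p

Adj : (p : ℕ) .{{_ : NonZero p}} → Triple → Triple → Set
Adj p x@(x₁ , x₂ , x₃) y@(y₁ , y₂ , y₃) =
  x ≢ y ×
  (x₂ + y₃) % p ≡ (x₁ * (y₁ * y₁)) % p ×
  (x₃ + y₂) % p ≡ ((x₁ * x₁) * y₁) % p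

-- Subtracting the adjacency equations of x and y at a common neighbour z gives, modulo p,
-- x₂ − y₂ ≡ (x₁ − y₁) z₁²  and  x₃ − y₃ ≡ (x₁² − y₁²) z₁ = (x₁ + y₁)(x₁ − y₁) z₁.
-- Elements of S lie strictly between 0 and p/2, so z₁ and x₁ + y₁ are units modulo p.
-- Hence equality in the second or third coordinate forces x₁ = y₁, and x₁ = y₁ forces the
-- remaining coordinates to agree, i.e. x = y.
module Submission where

open import Defs
open import Data.Nat using (ℕ; suc; zero; _<_; _≤_; _+_; _*_; _/_; ∣_-_∣; NonZero; z<s; s≤s; z≤n)
open import Data.Nat.DivMod using (_%_; m≡m%n+[m/n]*n; m/n*n≤m)
open import Data.Nat.Properties
open import Data.Nat.Divisibility using (_∣_; _∤_; divides; >⇒∤)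
open import Data.Nat.Primality using (Prime; euclidsLemma)
open import Data.Product using (_×_; _,_; ∃; proj₁)
open import Data.Sum using ([_,_])
open import Function using (id)
open import Relation.Nullary using (contradiction)
open import Relation.Binary.PropositionalEquality using (_≡_; _≢_; refl; sym; trans; cong; cong₂; subst; module ≡-Reasoning)

∣m*m-n*n∣≡[m+n]*∣m-n∣ : ∀ m n → ∣ m * m - n * n ∣ ≡ (m + n) * ∣ m - n ∣
∣m*m-n*n∣≡[m+n]*∣m-n∣ m n = begin
  ∣ m * m - n * n ∣                 ≡⟨ ∣m+n-m+o∣≡∣n-o∣ (n * m) (m * m) (n * n) ⟨
  ∣ n * m + m * m - n * m + n * n ∣ ≡⟨ cong₂ ∣_-_∣ (+-comm (n * m) (m * m)) (cong (_+ n * n) (*-comm n m)) ⟩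
  ∣ m * m + n * m - m * n + n * n ∣ ≡⟨ cong₂ ∣_-_∣ (*-distribʳ-+ m m n) (*-distribʳ-+ n m n) ⟨
  ∣ (m + n) * m - (m + n) * n ∣     ≡⟨ *-distribˡ-∣-∣ (m + n) m n ⟨
  (m + n) * ∣ m - n ∣               ∎
  where open ≡-Reasoning

m≤k/6⇒m+n≤k : ∀ {m n k} → m ≤ k / 6 → n ≤ k / 6 → m + n ≤ k
m≤k/6⇒m+n≤k {m} {n} {k} m≤ n≤ = begin
  m + n             ≤⟨ +-mono-≤ m≤ n≤ ⟩
  k / 6 + k / 6     ≡⟨ cong (k / 6 +_) (+-identityʳ (k / 6)) ⟨
  2 * (k / 6)       ≤⟨ *-monoˡ-≤ (k / 6) {2} {6} (s≤s (s≤s z≤n)) ⟩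
  6 * (k / 6)       ≡⟨ *-comm 6 (k / 6) ⟩
  k / 6 * 6         ≤⟨ m/n*n≤m k 6 ⟩
  k                 ∎
  where open ≤-Reasoning

InS-+-< : ∀ {p m n} → 5 ≤ p → InS p m → InS p n → m + n < p
InS-+-< 5≤p (_ , m≤ , _) (_ , n≤ , _) = ≤-<-trans (m≤k/6⇒m+n≤k m≤ n≤) (∸-monoʳ-< {o = 0} z<s 5≤p)

module _ {p : ℕ} .{{_ : NonZero p}} where

  %≡%⇒∣∣-∣ : ∀ m n → m % p ≡ n % p → p ∣ ∣ m - n ∣
  %≡%⇒∣∣-∣ m n eq = divides ∣ m / p - n / p ∣ (begin
    ∣ m - n ∣                                 ≡⟨ cong₂ ∣_-_∣ (m≡m%n+[m/n]*n m p) (m≡m%n+[m/n]*n n p) ⟩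
    ∣ m % p + m / p * p - n % p + n / p * p ∣ ≡⟨ cong (λ r → ∣ m % p + m / p * p - r + n / p * p ∣) eq ⟨
    ∣ m % p + m / p * p - m % p + n / p * p ∣ ≡⟨ ∣m+n-m+o∣≡∣n-o∣ (m % p) _ _ ⟩
    ∣ m / p * p - n / p * p ∣                 ≡⟨ *-distribʳ-∣-∣ p (m / p) (n / p) ⟨
    ∣ m / p - n / p ∣ * p                     ∎)
    where open ≡-Reasoning

  ∣∧<⇒≡0 : ∀ {n} → n < p → p ∣ n → n ≡ 0
  ∣∧<⇒≡0 {zero}  _   _   = refl
  ∣∧<⇒≡0 {suc n} n<p p∣n = contradiction p∣n (>⇒∤ n<p)

  0<n∧n<p⇒∤n : ∀ {n} → 0 < n → n < p → p ∤ n
  0<n∧n<p⇒∤n 0<n n<p p∣n = >⇒≢ 0<n (∣∧<⇒≡0 n<p p∣n)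

  ∣∣-∣∧<⇒≡ : ∀ {m n} → m < p → n < p → p ∣ ∣ m - n ∣ → m ≡ n
  ∣∣-∣∧<⇒≡ {m} {n} m<p n<p p∣ =
    ∣m-n∣≡0⇒m≡n (∣∧<⇒≡0 (≤-<-trans (∣m-n∣≤m⊔n m n) (⊔-pres-<m m<p n<p)) p∣)

  +-cancelʳ-%≡ : ∀ m n o → (m + o) % p ≡ (n + o) % p → p ∣ ∣ m - n ∣
  +-cancelʳ-%≡ m n o eq = subst (p ∣_) ∣m+o-n+o∣≡∣m-n∣ (%≡%⇒∣∣-∣ (m + o) (n + o) eq)
    where
    ∣m+o-n+o∣≡∣m-n∣ : ∣ m + o - n + o ∣ ≡ ∣ m - n ∣
    ∣m+o-n+o∣≡∣m-n∣ = trans (cong₂ ∣_-_∣ (+-comm m o) (+-comm n o)) (∣m+n-m+o∣≡∣n-o∣ o m n)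

  module _ (p-prime : Prime p) where

    ∣m*n∧∤n⇒∣m : ∀ {m n} → p ∣ m * n → p ∤ n → p ∣ m
    ∣m*n∧∤n⇒∣m {m} {n} p∣mn p∤n = [ id , (λ p∣n → contradiction p∣n p∤n) ] (euclidsLemma m n p-prime p∣mn)

    ∤m∧∤n⇒∤m*n : ∀ {m n} → p ∤ m → p ∤ n → p ∤ m * n
    ∤m∧∤n⇒∤m*n p∤m p∤n p∣mn = p∤m (∣m*n∧∤n⇒∣m p∣mn p∤n)

    *-cancelʳ-%≡ : ∀ m n {o} → p ∤ o → (m * o) % p ≡ (n * o) % p → p ∣ ∣ m - n ∣
    *-cancelʳ-%≡ m n {o} p∤o eq =
      ∣m*n∧∤n⇒∣m (subst (p ∣_) (sym (*-distribʳ-∣-∣ o m n)) (%≡%⇒∣∣-∣ (m * o) (n * o) eq)) p∤o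

    square-cancel-∣ : ∀ m n → p ∤ m + n → p ∣ ∣ m * m - n * n ∣ → p ∣ ∣ m - n ∣
    square-cancel-∣ m n p∤m+n p∣ =
      ∣m*n∧∤n⇒∣m (subst (p ∣_) (trans (∣m*m-n*n∣≡[m+n]*∣m-n∣ m n) (*-comm (m + n) _)) p∣) p∤m+n

lemma3p2 : (p : ℕ) .{{_ : NonZero p}} → Prime p → 11 < p → p % 6 ≡ 5 →
    (x₁ x₂ x₃ y₁ y₂ y₃ : ℕ) →
    InV p (x₁ , x₂ , x₃) → InV p (y₁ , y₂ , y₃) →
    (x₁ , x₂ , x₃) ≢ (y₁ , y₂ , y₃) →
    ∃ (λ z → InV p z × Adj p (x₁ , x₂ , x₃) z × Adj p (y₁ , y₂ , y₃) z) →
    x₁ ≢ y₁ × x₂ ≢ y₂ × x₃ ≢ y₃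
lemma3p2 p p-prime 11<p _ x₁ x₂ x₃ y₁ y₂ y₃ (x₁∈S , x₂<p , x₃<p) (y₁∈S , y₂<p , y₃<p) x≢y
  ((z₁ , z₂ , z₃) , (z₁∈S , _) , (_ , x₂z₃ , x₃z₂) , (_ , y₂z₃ , y₃z₂)) = x₁≢y₁ , x₂≢y₂ , x₃≢y₃
  where
  5≤p : 5 ≤ p
  5≤p = ≤-trans (m≤m+n 5 7) 11<p

  x₁+y₁<p : x₁ + y₁ < p
  x₁+y₁<p = InS-+-< 5≤p x₁∈S y₁∈S

  p∤z₁ : p ∤ z₁
  p∤z₁ = 0<n∧n<p⇒∤n (proj₁ z₁∈S) (≤-<-trans (m≤m+n z₁ z₁) (InS-+-< 5≤p z₁∈S z₁∈S))

  ∣∣x₁-y₁∣⇒x₁≡y₁ : p ∣ ∣ x₁ - y₁ ∣ → x₁ ≡ y₁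
  ∣∣x₁-y₁∣⇒x₁≡y₁ = ∣∣-∣∧<⇒≡ (≤-<-trans (m≤m+n x₁ y₁) x₁+y₁<p) (≤-<-trans (m≤n+m y₁ x₁) x₁+y₁<p)

  x₁≢y₁ : x₁ ≢ y₁
  x₁≢y₁ refl = x≢y (cong (x₁ ,_) (cong₂ _,_
    (∣∣-∣∧<⇒≡ x₂<p y₂<p (+-cancelʳ-%≡ x₂ y₂ z₃ (trans x₂z₃ (sym y₂z₃))))
    (∣∣-∣∧<⇒≡ x₃<p y₃<p (+-cancelʳ-%≡ x₃ y₃ z₂ (trans x₃z₂ (sym y₃z₂))))))

  x₂≢y₂ : x₂ ≢ y₂
  x₂≢y₂ refl = x₁≢y₁ (∣∣x₁-y₁∣⇒x₁≡y₁
    (*-cancelʳ-%≡ p-prime x₁ y₁ (∤m∧∤n⇒∤m*n p-prime p∤z₁ p∤z₁) (trans (sym x₂z₃) y₂z₃)))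

  x₃≢y₃ : x₃ ≢ y₃
  x₃≢y₃ refl = x₁≢y₁ (∣∣x₁-y₁∣⇒x₁≡y₁ (square-cancel-∣ p-prime x₁ y₁
    (0<n∧n<p⇒∤n (≤-trans (proj₁ x₁∈S) (m≤m+n x₁ y₁)) x₁+y₁<p)
    (*-cancelʳ-%≡ p-prime (x₁ * x₁) (y₁ * y₁) p∤z₁ (trans (sym x₃z₂) y₃z₂))))
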